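{- Let $G$ be a finite connected graph and $i\le \mathrm{rad}(G)$ a non-negative integer. If for any two vertices $x,y\in V(G)$ with $d(x,y)=i$ there exists $y'\in N(y)$ with $d(x,y')=i+1$, then $\mathrm{rc}(G)\ge i$.
   Context: $N(y)$ is the open neighborhood of $y$, $d$ the shortest-path distance, $\mathrm{rad}(G)$ the radius. Cop and robber game with radius of capture $k$: first the cop chooses a vertex, then the robber; afterwards, starting with the cop, the players alternately either move to an adjacent vertex or stay put, both knowing both positions. The cop wins if at some point the distance between the players is at most $k$. $\mathcal{CWRC}(k)$ is the class of graphs on which the cop has a winning strategy. $\mathrm{rc}(G)=\min\{k\in\mathbb{N}_0 \mid G\in\mathcal{CWRC}(k)\}$. -}

module Defs where

open import Level using (0ℓ)
open import Data.Nat using (ℕ; zero; suc; _≤_)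
open import Data.Fin using (Fin)
open import Data.Bool using (Bool; true; false; not)
open import Data.Product using (Σ; ∃; _×_; _,_; proj₁; proj₂)
open import Data.Sum using (_⊎_)
open import Data.List using (List; []; _∷_)
open import Relation.Nullary using (¬_)
open import Relation.Binary.PropositionalEquality using (_≡_)

record Graph : Set₁ where
  field
    n      : ℕ
    E      : Fin n → Fin n → Set
    sym    : ∀ {x y} → E x y → E y x
    irrefl : ∀ {x} → ¬ E x x

module _ (G : Graph) where
  open Graph G

  V : Set
  V = Fin n

  data Walk : V → V → ℕ → Set where
    here : ∀ {x} → Walk x x zero
    step : ∀ {x z y m} → E x z → Walk z y m → Walk x y (suc m)

  Connected : Set
  Connected = ∀ (x y : V) → ∃ λ m → Walk x y m

  Dist : V → V → ℕ → Set
  Dist x y m = Walk x y m × (∀ m' → Walk x y m' → m ≤ m')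

  IsEcc : V → ℕ → Set
  IsEcc x e = (∃ λ y → Dist x y e) × (∀ y m → Dist x y m → m ≤ e)

  IsRadius : ℕ → Set
  IsRadius r = (∃ λ x → IsEcc x r) × (∀ x e → IsEcc x e → r ≤ e)

  Move : V → V → Set
  Move a b = a ≡ b ⊎ E a b

  -- A position: (cop vertex, robber vertex).
  Pos : Set
  Pos = V × V

  -- Strategies see the current position and the full history of earlier
  -- positions (most recent first).
  record CopStrategy : Set where
    field
      start : V
      move  : Pos → List Pos → V
      legal : ∀ p h → Move (proj₁ p) (move p h)

  record RobberStrategy : Set where
    field
      start : V → V            -- chosen after seeing the cop's start
      move  : Pos → List Pos → V
      legal : ∀ p h → Move (proj₂ p) (move p h)

  -- State after a number of single moves: whose turn it is (true = cop),
  -- current position, history of earlier positions.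
  record State : Set where
    constructor st
    field
      copTurn : Bool
      pos     : Pos
      hist    : List Pos

  run : CopStrategy → RobberStrategy → ℕ → State
  run σ τ zero = st true (c₀ , RobberStrategy.start τ c₀) []
    where c₀ = CopStrategy.start σ
  run σ τ (suc t) with run σ τ t
  ... | st true  (c , r) h = st false (CopStrategy.move σ (c , r) h , r) ((c , r) ∷ h)
  ... | st false (c , r) h = st true  (c , RobberStrategy.move τ (c , r) h) ((c , r) ∷ h)

  position : CopStrategy → RobberStrategy → ℕ → Pos
  position σ τ t = State.pos (run σ τ t)

  CopWins : ℕ → Set
  CopWins k = Σ CopStrategy λ σ → ∀ (τ : RobberStrategy) →
    ∃ λ t → ∃ λ m → Dist (proj₁ (position σ τ t)) (proj₂ (position σ τ t)) m × m ≤ k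

  -- rc(G) ≥ i, where rc(G) = min { k | G ∈ CWRC(k) }.
  RcAtLeast : ℕ → Set
  RcAtLeast i = ∀ k → CopWins k → i ≤ k

{-# OPTIONS --safe #-}
module Submission where

-- Against a cop who must get within distance k < i, the robber starts at distance
-- at least i + 1 from the cop: a vertex of maximal distance works, since
-- ecc(c) ≥ rad(G) ≥ i and, if that distance is exactly i, the hypothesis pushes it to
-- i + 1. Whenever a cop move brings the distance down to i, the robber steps to a
-- neighbour at distance i + 1; otherwise he stays. So the distance never drops below
-- i. The robber's choice needs d(c, r) = i to be decidable, which holds only
-- classically; since i ≤ k is decidable, arguing under a double negation suffices.

open import Level using (0ℓ)
open import Data.Nat using (ℕ; zero; suc; _≤_; _<_)
open import Data.Nat.Properties
  using (≤-trans; ≤-antisym; ≤-pred; n≤1+n; ≮⇒≥; m≤n⇒m<n∨m≡n; _≤?_)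
open import Data.Nat.Induction using (<-rec)
open import Data.Fin using (Fin; zero; suc)
open import Data.Bool using (true; false)
open import Data.Product using (Σ; ∃; _×_; _,_; proj₁; proj₂)
open import Data.Sum using (inj₁; inj₂)
open import Data.List using (allFin)
import Data.List.Relation.Unary.All as All
open import Data.List.Membership.Propositional.Properties using (∈-allFin)
open import Data.List.Extrema.Nat using (argmax; f[xs]≤f[argmax])
open import Effect.Monad using (RawMonad)
open import Relation.Nullary using (¬_; Dec; yes; no)
open import Relation.Nullary.Negation using (DoubleNegation; ¬¬-Monad; contradiction)
open import Relation.Nullary.Decidable using (¬¬-excluded-middle; decidable-stable)
open import Relation.Binary.PropositionalEquality using (_≡_; refl; subst)

open import Defs

open RawMonad (¬¬-Monad {a = 0ℓ})

¬¬-∀Fin : ∀ {n} {Q : Fin n → Set} → (∀ x → DoubleNegation (Q x)) →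
          DoubleNegation (∀ x → Q x)
¬¬-∀Fin {zero} q = return λ ()
¬¬-∀Fin {suc n} q = do
  q₀ ← q zero
  qₛ ← ¬¬-∀Fin (λ x → q (suc x))
  return λ { zero → q₀ ; (suc x) → qₛ x }

¬¬-least : (P : ℕ → Set) → ∀ {M} → P M →
           DoubleNegation (∃ λ m → P m × ∀ m′ → P m′ → m ≤ m′)
¬¬-least P {M} = <-rec (λ M → P M → DoubleNegation Least) least-below M
  where
  Least : Set
  Least = ∃ λ m → P m × ∀ m′ → P m′ → m ≤ m′

  least-below : ∀ M → (∀ {m} → m < M → P m → DoubleNegation Least) →
                P M → DoubleNegation Least
  least-below M smaller pM = ¬¬-excluded-middle {A = ∃ λ m → m < M × P m} >>= λ where
    (yes (m , m<M , pm)) → smaller m<M pm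
    (no none)            → return (M , pM , λ m′ pm′ → ≮⇒≥ λ m′<M → none (m′ , m′<M , pm′))

module _ {G : Graph} where
  open Graph G using (n; E)

  DistAtLeast : ℕ → V G → V G → Set
  DistAtLeast j x y = ∀ m → Walk G x y m → j ≤ m

  distAtLeast-pred : ∀ {j x y} → DistAtLeast (suc j) x y → DistAtLeast j x y
  distAtLeast-pred {j} far m w = ≤-trans (n≤1+n j) (far m w)

  distAtLeast-move : ∀ {j x x′ y} → Move G x x′ → DistAtLeast (suc j) x y → DistAtLeast j x′ y
  distAtLeast-move (inj₁ refl) far = distAtLeast-pred far
  distAtLeast-move (inj₂ e)    far m w = ≤-pred (far (suc m) (step e w))

  distAtLeast-suc : ∀ {j x y} → DistAtLeast j x y → ¬ Dist G x y j → DistAtLeast (suc j) x y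
  distAtLeast-suc far ¬dist m w with m≤n⇒m<n∨m≡n (far m w)
  ... | inj₁ j<m  = j<m
  ... | inj₂ refl = contradiction (w , far) ¬dist

  dist⇒distAtLeast : ∀ {j m x y} → Dist G x y m → j ≤ m → DistAtLeast j x y
  dist⇒distAtLeast (_ , shortest) j≤m m′ w = ≤-trans j≤m (shortest m′ w)

  dist-unique : ∀ {x y m m′} → Dist G x y m → Dist G x y m′ → m ≡ m′
  dist-unique (w , shortest) (w′ , shortest′) = ≤-antisym (shortest _ w′) (shortest′ _ w)

  ¬¬-dist : Connected G → ∀ x y → DoubleNegation (∃ (Dist G x y))
  ¬¬-dist conn x y = ¬¬-least (Walk G x y) (proj₂ (conn x y))

  ¬¬-ecc : Connected G → ∀ x → DoubleNegation (∃ (IsEcc G x))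
  ¬¬-ecc conn x = do
    dist ← ¬¬-∀Fin (¬¬-dist conn x)
    let d y = proj₁ (dist y)
        far = argmax d x (allFin n)
        farthest y = All.lookup (f[xs]≤f[argmax] x (allFin n)) (∈-allFin y)
    return (d far , (far , proj₂ (dist far)) , λ y m dm →
      subst (_≤ d far) (dist-unique (proj₂ (dist y)) dm) (farthest y))

  Escapable : ℕ → Set
  Escapable i = ∀ x y → Dist G x y i → ∃ λ y′ → E y y′ × Dist G x y′ (suc i)

  ¬¬-escapeStart : Connected G → ∀ {r i} → IsRadius G r → i ≤ r → Escapable i →
                   ∀ c → DoubleNegation (∃ (DistAtLeast (suc i) c))
  ¬¬-escapeStart conn {i = i} (_ , radius-min) i≤r escape c = do
    e , ecc@((y , dy) , _) ← ¬¬-ecc conn c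
    return (escapeFrom y dy (≤-trans i≤r (radius-min c e ecc)))
    where
    escapeFrom : ∀ {e} y → Dist G c y e → i ≤ e → ∃ (DistAtLeast (suc i) c)
    escapeFrom y dy i≤e with m≤n⇒m<n∨m≡n i≤e
    ... | inj₁ i<e  = y , dist⇒distAtLeast dy i<e
    ... | inj₂ refl = let y′ , _ , dy′ = escape c y dy in y′ , proj₂ dy′

  Evades : ℕ → CopStrategy G → RobberStrategy G → Set
  Evades i σ τ = ∀ t → DistAtLeast i (proj₁ (position G σ τ t)) (proj₂ (position G σ τ t))

  module Evader {i} (escape : Escapable i) (dist? : ∀ c r → Dec (Dist G c r i)) (y₀ : V G) where

    respond : V G → V G → V G
    respond c r with dist? c r
    ... | yes d = proj₁ (escape c r d)
    ... | no _  = r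

    respond-legal : ∀ c r → Move G r (respond c r)
    respond-legal c r with dist? c r
    ... | yes d = inj₂ (proj₁ (proj₂ (escape c r d)))
    ... | no _  = inj₁ refl

    respond-escapes : ∀ {c r} → DistAtLeast i c r → DistAtLeast (suc i) c (respond c r)
    respond-escapes {c} {r} far with dist? c r
    ... | yes d = proj₂ (proj₂ (proj₂ (escape c r d)))
    ... | no ¬d = distAtLeast-suc far ¬d

    evader : RobberStrategy G
    evader = record
      { start = λ _ → y₀
      ; move  = λ (c , r) _ → respond c r
      ; legal = λ (c , r) _ → respond-legal c r
      }

    Invariant : State G → Set
    Invariant (st true  (c , r) _) = DistAtLeast (suc i) c r
    Invariant (st false (c , r) _) = DistAtLeast i c r

    invariant⇒distAtLeast : ∀ s → Invariant s →
                            DistAtLeast i (proj₁ (State.pos s)) (proj₂ (State.pos s))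
    invariant⇒distAtLeast (st true  _ _) far = distAtLeast-pred far
    invariant⇒distAtLeast (st false _ _) far = far

    module _ (σ : CopStrategy G) (far₀ : DistAtLeast (suc i) (CopStrategy.start σ) y₀) where
      open CopStrategy σ using (legal)

      invariant : ∀ t → Invariant (run G σ evader t)
      invariant zero = far₀
      invariant (suc t) with run G σ evader t | invariant t
      ... | st true  (c , r) h | far = distAtLeast-move (legal (c , r) h) far
      ... | st false (c , r) h | far = respond-escapes far

      evader-evades : Evades i σ evader
      evader-evades t = invariant⇒distAtLeast (run G σ evader t) (invariant t)

  ¬¬-evasion : Connected G → ∀ {r i} → IsRadius G r → i ≤ r → Escapable i →
               ∀ σ → DoubleNegation (∃ (Evades i σ))
  ¬¬-evasion conn radius i≤r escape σ = do
    dist? ← ¬¬-∀Fin λ c → ¬¬-∀Fin λ r → ¬¬-excluded-middle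
    y₀ , far₀ ← ¬¬-escapeStart conn radius i≤r escape (CopStrategy.start σ)
    let open Evader escape dist? y₀
    return (evader , evader-evades σ far₀)

lemma4p7 : (G : Graph) → Connected G → (i : ℕ) →
    (Σ ℕ λ r → IsRadius G r × i ≤ r) →
    (∀ x y → Dist G x y i → ∃ λ y' → Graph.E G y y' × Dist G x y' (suc i)) →
    RcAtLeast G i
lemma4p7 G conn i (_ , radius , i≤r) escape k (σ , σ-wins) =
  decidable-stable (i ≤? k) λ i≰k → ¬¬-evasion conn radius i≤r escape σ λ (τ , evades) →
    let t , m , (w , _) , m≤k = σ-wins τ in i≰k (≤-trans (evades t m w) m≤k)
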